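{- Let $H$ be an undirected graph and let $I$ be an induced minor of $H$. Then $\operatorname{dtw}(H)\ge \operatorname{dtw}(I)$.
   Context: $I$ is an induced minor of $H$ if $I$ can be obtained from $H$ by deleting vertices and contracting edges. For a DAG $\vec H$, a source is a vertex of indegree $0$, $S$ is the set of sources, $R(s)$ is the set of vertices reachable from $s$ by a directed path, and $R(B)=\bigcup_{s\in B}R(s)$. A DAG tree decomposition of $\vec H$ is a tree $T$ whose nodes are bags $B\subseteq S$ such that every source lies in some bag and, for any bags $B,B_1,B_2$ with $B$ on the unique path between $B_1$ and $B_2$, $R(B_1)\cap R(B_2)\subseteq R(B)$; its width is the maximum bag size and $\operatorname{dtw}(\vec H)$ is the minimum width. For an undirected graph $H$, $\operatorname{dtw}(H)$ is the maximum of $\operatorname{dtw}(\vec H)$ over all acyclic orientations $\vec H$ of $H$. -}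

module Defs where

open import Level using (0ℓ)
open import Data.Nat using (ℕ; zero; suc; _≤_; _⊔_)
open import Data.Fin using (Fin; punchIn)
open import Data.Fin.Subset using (Subset; _∈_; ∣_∣)
open import Data.List using (List; []; _∷_)
open import Data.List.Relation.Unary.Unique.Propositional using (Unique)
import Data.List.Membership.Propositional as LM
open import Data.Product using (Σ; ∃; ∃-syntax; _×_; _,_)
open import Data.Sum using (_⊎_)
open import Relation.Nullary using (¬_)
open import Relation.Binary.PropositionalEquality using (_≡_; _≢_)
open import Relation.Binary.Construct.Closure.ReflexiveTransitive using (Star)
open import Function.Bundles using (_↔_; _⇔_)

record Graph (n : ℕ) : Set₁ where
  field
    Adj    : Fin n → Fin n → Set
    sym    : ∀ {x y} → Adj x y → Adj y x
    irrefl : ∀ {x} → ¬ Adj x x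
open Graph public

record _≅_ {m n : ℕ} (G : Graph m) (H : Graph n) : Set₁ where
  field
    bij      : Fin m ↔ Fin n
  open Function.Bundles.Inverse bij public using (to)
  field
    preserve : ∀ x y → (Adj G x y ⇔ Adj H (to x) (to y))

deleteVertex : ∀ {n} → Graph (suc n) → Fin (suc n) → Graph n
deleteVertex G v = record
  { Adj    = λ x y → Adj G (punchIn v x) (punchIn v y)
  ; sym    = Graph.sym G
  ; irrefl = Graph.irrefl G
  }

-- Contracting the edge u v: v is removed and merged into u
-- (loops and parallel edges are discarded, so the result is simple).
contractAdj : ∀ {n} → Graph (suc n) → Fin (suc n) → Fin (suc n) →
              Fin n → Fin n → Set
contractAdj G u v x y =
  x ≢ y × ( Adj G (punchIn v x) (punchIn v y)
          ⊎ (punchIn v x ≡ u × Adj G v (punchIn v y))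
          ⊎ (punchIn v y ≡ u × Adj G (punchIn v x) v))

private
  ≢-sym : ∀ {A : Set} {a b : A} → a ≢ b → b ≢ a
  ≢-sym p q = p (Relation.Binary.PropositionalEquality.sym q)

contract : ∀ {n} (G : Graph (suc n)) (u v : Fin (suc n)) → Adj G u v → Graph n
contract G u v _ = record
  { Adj    = contractAdj G u v
  ; sym    = λ { (x≢y , Data.Sum.inj₁ a) → ≢-sym x≢y , Data.Sum.inj₁ (Graph.sym G a)
               ; (x≢y , Data.Sum.inj₂ (Data.Sum.inj₁ (e , a))) →
                   ≢-sym x≢y , Data.Sum.inj₂ (Data.Sum.inj₂ (e , Graph.sym G a))
               ; (x≢y , Data.Sum.inj₂ (Data.Sum.inj₂ (e , a))) →
                   ≢-sym x≢y , Data.Sum.inj₂ (Data.Sum.inj₁ (e , Graph.sym G a)) }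
  ; irrefl = λ { (x≢x , _) → x≢x Relation.Binary.PropositionalEquality.refl }
  }

data IndMinor {m : ℕ} (I : Graph m) : {n : ℕ} → Graph n → Set₁ where
  iso  : ∀ {n} {H : Graph n} → I ≅ H → IndMinor I H
  del  : ∀ {n} {H : Graph (suc n)} (v : Fin (suc n)) →
         IndMinor I (deleteVertex H v) → IndMinor I H
  con  : ∀ {n} {H : Graph (suc n)} (u v : Fin (suc n)) (e : Adj H u v) →
         IndMinor I (contract H u v e) → IndMinor I H

record IsOrientation {n : ℕ} (G : Graph n) (D : Fin n → Fin n → Set) : Set where
  field
    arc⇒edge : ∀ {x y} → D x y → Adj G x y
    edge⇒arc : ∀ {x y} → Adj G x y → D x y ⊎ D y x
    antisym  : ∀ {x y} → D x y → ¬ D y x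

Reach : ∀ {n} → (Fin n → Fin n → Set) → Fin n → Fin n → Set
Reach D = Star D

IsAcyclic : ∀ {n} → (Fin n → Fin n → Set) → Set
IsAcyclic D = ∀ {x y} → D x y → ¬ Reach D y x

record AcyclicOrientation {n : ℕ} (G : Graph n) : Set₁ where
  field
    D       : Fin n → Fin n → Set
    isOrient : IsOrientation G D
    acyclic : IsAcyclic D
open AcyclicOrientation public

IsSource : ∀ {n} → (Fin n → Fin n → Set) → Fin n → Set
IsSource D s = ∀ u → ¬ D u s

RB : ∀ {n} → (Fin n → Fin n → Set) → Subset n → Fin n → Set
RB D B v = ∃[ s ] (s ∈ B × Reach D s v)

data Walk {k : ℕ} (T : Graph k) : Fin k → Fin k → Set where
  []  : ∀ {x} → Walk T x x
  _∷_ : ∀ {x y z} → Adj T x y → Walk T y z → Walk T x z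

verts : ∀ {k} {T : Graph k} {x y} → Walk T x y → List (Fin k)
verts {x = x} []      = x ∷ []
verts {x = x} (_ ∷ w) = x ∷ verts w

Path : ∀ {k} (T : Graph k) → Fin k → Fin k → Set
Path T x y = Σ (Walk T x y) (λ w → Unique (verts w))

record IsTree {k : ℕ} (T : Graph k) : Set where
  field
    path   : ∀ x y → Path T x y
    unique : ∀ x y (p q : Path T x y) → verts (Data.Product.proj₁ p) ≡ verts (Data.Product.proj₁ q)

OnPath : ∀ {k} (T : Graph k) → Fin k → Fin k → Fin k → Set
OnPath T b b₁ b₂ = Σ (Path T b₁ b₂) (λ p → b LM.∈ verts (Data.Product.proj₁ p))

maxOver : (k : ℕ) → (Fin k → ℕ) → ℕ
maxOver zero    f = 0
maxOver (suc k) f = f Data.Fin.zero ⊔ maxOver k (λ i → f (Data.Fin.suc i))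

record DagTreeDecomposition {n : ℕ} (D : Fin n → Fin n → Set) : Set₁ where
  field
    k         : ℕ
    T         : Graph k
    isTree    : IsTree T
    bag       : Fin k → Subset n
    bagSrc    : ∀ b {s} → s ∈ bag b → IsSource D s
    cover     : ∀ s → IsSource D s → ∃[ b ] (s ∈ bag b)
    interpol  : ∀ b b₁ b₂ → OnPath T b b₁ b₂ →
                ∀ v → RB D (bag b₁) v → RB D (bag b₂) v → RB D (bag b) v
open DagTreeDecomposition public

width : ∀ {n} {D : Fin n → Fin n → Set} → DagTreeDecomposition D → ℕ
width dec = maxOver (k dec) (λ b → ∣ bag dec b ∣)

IsDagDtw : ∀ {n} → (Fin n → Fin n → Set) → ℕ → Set₁
IsDagDtw D w = (∃[ dec ] (width {D = D} dec ≡ w))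
             × (∀ (dec : DagTreeDecomposition D) → w ≤ width dec)

IsDtw : ∀ {n} → Graph n → ℕ → Set₁
IsDtw G w = (∃[ O ] IsDagDtw (D {G = G} O) w)
          × (∀ (O : AcyclicOrientation G) w' → IsDagDtw (D O) w' → w' ≤ w)

-- It suffices to treat a single isomorphism, vertex deletion or edge contraction,
-- since the inequality composes along the minor sequence.  In each case an acyclic
-- orientation of I is extended to one of H: a deleted vertex becomes a sink, and a
-- contracted edge u v is oriented t → h with {t, h} = {u, v} chosen so that t is a
-- source exactly when the merged vertex is.  A DAG tree decomposition of H then
-- restricts to one of I on the same tree, with bags the preimages of the bags under an
-- injection V(I) → V(H) matching up the sources, so its width does not grow.  Being a
-- source is not decidable here, so the argument runs in the double-negation monad;
-- this suffices because the conclusion b ≤ a is decidable.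

module Submission where

open import Defs hiding (sym)
open import Level using (Level)
open import Data.Nat as ℕ using (ℕ; zero; suc; _≤_; _<_; z≤n; s≤s)
import Data.Nat.Properties as ℕ
open import Data.Nat.Induction using (<-rec)
open import Data.Bool using (Bool)
open import Data.Bool.Properties using (T-≡)
open import Data.Empty using (⊥)
open import Data.Fin as Fin using (Fin; punchIn; punchOut)
import Data.Fin.Properties as Fin
open import Data.Fin.Subset using (Subset; _∈_; ∣_∣; inside; outside; _-_; _⊆_)
open import Data.Fin.Subset.Properties using (x∈p∧x≢y⇒x∈p-y; p⊆q⇒∣p∣≤∣q∣; x∈p⇒∣p-x∣<∣p∣; ∣p─q∣≤∣p∣)
open import Data.Vec using (_∷_; lookup; tabulate)
import Data.Vec.Properties as Vec
open import Data.Product as Product using (Σ; ∃-syntax; _×_; _,_; proj₁; proj₂)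
open import Data.Sum as Sum using (_⊎_; inj₁; inj₂)
open import Data.List using (List)
open import Data.List.Membership.Propositional using () renaming (_∈_ to _∈ₗ_)
open import Data.List.Relation.Unary.Any using (here; there)
open import Data.List.Relation.Unary.All using ([])
import Data.List.Relation.Unary.All.Properties as All
open import Data.List.Relation.Unary.AllPairs using ([]; _∷_)
open import Function using (Injective; _∘_; id; _⇔_; Equivalence; mk⇔; Inverse)
open import Relation.Nullary using (¬_; yes; no)
open import Relation.Nullary.Negation using (¬¬-map; negated-stable; contradiction; contraposition; ¬∃⟶∀¬)
open import Relation.Nullary.Decidable using (¬¬-excluded-middle; decidable-stable; isYes; toWitness; fromWitness)
open import Relation.Binary.PropositionalEquality
open import Relation.Binary.Construct.Closure.ReflexiveTransitive using (ε; _◅_; _◅◅_; gmap)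

private variable
  a b : Level
  A : Set a
  B : Set b

_>>=_ : ¬ ¬ A → (A → ¬ ¬ B) → ¬ ¬ B
m >>= f = negated-stable (¬¬-map f m)

return : A → ¬ ¬ A
return = contradiction

¬¬-∀-Fin : ∀ {n} {P : Fin n → Set} → (∀ i → ¬ ¬ P i) → ¬ ¬ (∀ i → P i)
¬¬-∀-Fin {zero}  h = return λ ()
¬¬-∀-Fin {suc n} h = do
  p₀ ← h Fin.zero
  ps ← ¬¬-∀-Fin (λ i → h (Fin.suc i))
  return λ { Fin.zero → p₀ ; (Fin.suc i) → ps i }

Least : ∀ {p} → (ℕ → Set p) → ℕ → Set p
Least P w = P w × (∀ j → P j → w ≤ j)

¬¬-least : ∀ {p} (P : ℕ → Set p) {k} → P k → ¬ ¬ (∃[ w ] Least P w)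
¬¬-least P {k} = <-rec (λ k → P k → ¬ ¬ (∃[ w ] Least P w)) step k
  where
  step : ∀ k → (∀ {j} → j < k → P j → ¬ ¬ (∃[ w ] Least P w)) → P k → ¬ ¬ (∃[ w ] Least P w)
  step k ih pk = do
    yes (j , j<k , pj) ← ¬¬-excluded-middle {A = ∃[ j ] (j < k × P j)}
      where no ∄j → return (k , pk , λ j pj → ℕ.≮⇒≥ λ j<k → ∄j (j , j<k , pj))
    ih j<k pj

preimage : ∀ {m n} → (Fin m → Fin n) → Subset n → Subset m
preimage f S = tabulate (λ x → lookup S (f x))

∈-tabulate⇔ : ∀ {n} (g : Fin n → Bool) {x} → x ∈ tabulate g ⇔ g x ≡ inside
∈-tabulate⇔ g {x} = mk⇔
  (λ x∈ → trans (sym (Vec.lookup∘tabulate g x)) (Vec.[]=⇒lookup x∈))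
  (λ gx → Vec.lookup⇒[]= x _ (trans (Vec.lookup∘tabulate g x) gx))

∈-preimage⁻ : ∀ {m n} (f : Fin m → Fin n) {S x} → x ∈ preimage f S → f x ∈ S
∈-preimage⁻ f {S} x∈ = Vec.lookup⇒[]= _ S (Equivalence.to (∈-tabulate⇔ _) x∈)

∈-preimage⁺ : ∀ {m n} (f : Fin m → Fin n) {S x} → f x ∈ S → x ∈ preimage f S
∈-preimage⁺ f fx∈ = Equivalence.from (∈-tabulate⇔ _) (Vec.[]=⇒lookup fx∈)

∣preimage∣≤ : ∀ {m n} (f : Fin m → Fin n) → Injective _≡_ _≡_ f →
              ∀ S → ∣ preimage f S ∣ ≤ ∣ S ∣

∣preimage∘suc∣≤ : ∀ {m n} (f : Fin (suc m) → Fin n) → Injective _≡_ _≡_ f →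
                  ∀ S → ∣ preimage (f ∘ Fin.suc) S ∣ ≤ ∣ S - f Fin.zero ∣
∣preimage∘suc∣≤ f f-inj S = ℕ.≤-trans (p⊆q⇒∣p∣≤∣q∣ shrink) (∣preimage∣≤ (f ∘ Fin.suc) (Fin.suc-injective ∘ f-inj) (S - f Fin.zero))
  where
  shrink : preimage (f ∘ Fin.suc) S ⊆ preimage (f ∘ Fin.suc) (S - f Fin.zero)
  shrink {x} x∈ = ∈-preimage⁺ (f ∘ Fin.suc)
    (x∈p∧x≢y⇒x∈p-y {p = S} (∈-preimage⁻ (f ∘ Fin.suc) {S} x∈) (Fin.0≢1+n ∘ sym ∘ f-inj))

∣preimage∣≤ {zero}  f f-inj S = z≤n
∣preimage∣≤ {suc m} f f-inj S with lookup S (f Fin.zero) in f₀∈S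
... | inside  = ℕ.≤-trans (s≤s (∣preimage∘suc∣≤ f f-inj S)) (x∈p⇒∣p-x∣<∣p∣ (Vec.lookup⇒[]= _ S f₀∈S))
... | outside = ℕ.≤-trans (∣preimage∘suc∣≤ f f-inj S) (∣p─q∣≤∣p∣ S _)

maxOver-mono-≤ : ∀ k {f g : Fin k → ℕ} → (∀ i → f i ≤ g i) → maxOver k f ≤ maxOver k g
maxOver-mono-≤ zero    f≤g = z≤n
maxOver-mono-≤ (suc k) f≤g = ℕ.⊔-mono-≤ (f≤g Fin.zero) (maxOver-mono-≤ k (f≤g ∘ Fin.suc))

module PunchIn {n} (v : Fin (suc n)) where

  ↑ : Fin n → Fin (suc n)
  ↑ = punchIn v

  ↑-injective : ∀ {x y} → ↑ x ≡ ↑ y → x ≡ y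
  ↑-injective = Fin.punchIn-injective v _ _

  ↑≢v : ∀ x → ↑ x ≢ v
  ↑≢v = Fin.punchInᵢ≢i v

  ↑-view : ∀ a → a ≡ v ⊎ ∃[ x ] a ≡ ↑ x
  ↑-view a with a Fin.≟ v
  ... | yes a≡v = inj₁ a≡v
  ... | no  a≢v = inj₂ (punchOut (a≢v ∘ sym) , sym (Fin.punchIn-punchOut _))

module _ {k : ℕ} (T : Graph k) where

  open import Data.List.Membership.DecPropositional (Fin._≟_ {k}) using (_∈?_)

  _++ʷ_ : ∀ {x y z} → Walk T x y → Walk T y z → Walk T x z
  []      ++ʷ q = q
  (e ∷ p) ++ʷ q = e ∷ (p ++ʷ q)

  ∈-verts-++ʷ⁻ : ∀ {x y z b} (p : Walk T x y) (q : Walk T y z) →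
                 b ∈ₗ verts (p ++ʷ q) → b ∈ₗ verts p ⊎ b ∈ₗ verts q
  ∈-verts-++ʷ⁻ []      q b∈         = inj₂ b∈
  ∈-verts-++ʷ⁻ (e ∷ p) q (here b≡x) = inj₁ (here b≡x)
  ∈-verts-++ʷ⁻ (e ∷ p) q (there b∈) = Sum.map₁ there (∈-verts-++ʷ⁻ p q b∈)

  private
    _⊆ₗ_ : List (Fin k) → List (Fin k) → Set
    xs ⊆ₗ ys = ∀ {b} → b ∈ₗ xs → b ∈ₗ ys

  pathSuffix : ∀ {x y z} (p : Path T y z) → x ∈ₗ verts (proj₁ p) →
               Σ (Path T x z) λ q → verts (proj₁ q) ⊆ₗ verts (proj₁ p)
  pathSuffix ([] , u)         (here refl) = ([] , u) , id
  pathSuffix ((e ∷ p) , u)    (here refl) = ((e ∷ p) , u) , id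
  pathSuffix ((e ∷ p) , _ ∷ u) (there x∈) = Product.map₂ (λ q⊆p b∈ → there (q⊆p b∈)) (pathSuffix (p , u) x∈)

  walk⇒path : ∀ {x y} (w : Walk T x y) → Σ (Path T x y) λ p → verts (proj₁ p) ⊆ₗ verts w
  walk⇒path []      = ([] , [] ∷ []) , id
  walk⇒path {x} (e ∷ w) with walk⇒path w
  ... | (p , u) , p⊆w with x ∈? verts p
  ...   | yes x∈p = Product.map₂ (λ q⊆p b∈ → there (p⊆w (q⊆p b∈))) (pathSuffix (p , u) x∈p)
  ...   | no  x∉p = ((e ∷ p) , (All.¬Any⇒All¬ (verts p) x∉p ∷ u)) , λ { (here b≡x) → here b≡x ; (there b∈) → there (p⊆w b∈) }

  -- The b₁–b₂ path is the shortcut of the walk b₁ ⇝ b₀ ⇝ b₂, so b lies on one of its halves.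
  onPath-split : IsTree T → ∀ {b b₁ b₂} → OnPath T b b₁ b₂ → ∀ b₀ →
                 OnPath T b b₁ b₀ ⊎ OnPath T b b₀ b₂
  onPath-split tree {b} {b₁} {b₂} (p₁₂ , b∈p₁₂) b₀ =
    Sum.map (p₁₀ ,_) (p₀₂ ,_) (∈-verts-++ʷ⁻ (proj₁ p₁₀) (proj₁ p₀₂) (p⊆w b∈p))
    where
    p₁₀ = IsTree.path tree b₁ b₀
    p₀₂ = IsTree.path tree b₀ b₂
    p = walk⇒path (proj₁ p₁₀ ++ʷ proj₁ p₀₂)
    p⊆w = proj₂ p
    b∈p : b ∈ₗ verts (proj₁ (proj₁ p))
    b∈p = subst (b ∈ₗ_) (IsTree.unique tree b₁ b₂ p₁₂ (proj₁ p)) b∈p₁₂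

module _ {n : ℕ} {D : Fin n → Fin n → Set} (acyclic : IsAcyclic D) where

  data Chain : ℕ → Fin n → Fin n → Set where
    []  : ∀ {a} → Chain zero a a
    _∷_ : ∀ {k c c′ a} → D c c′ → Chain k c′ a → Chain (suc k) c a

  chain⇒reach : ∀ {k c a} → Chain k c a → Reach D c a
  chain⇒reach []      = ε
  chain⇒reach (d ∷ p) = d ◅ chain⇒reach p

  vertexAt : ∀ {k c a} → Chain k c a → Fin (suc k) → Fin n
  vertexAt {c = c} []      _            = c
  vertexAt {c = c} (d ∷ p) Fin.zero     = c
  vertexAt         (d ∷ p) (Fin.suc i)  = vertexAt p i

  vertexAt-reach : ∀ {k c a} (p : Chain k c a) i → Reach D c (vertexAt p i)
  vertexAt-reach []      _           = ε
  vertexAt-reach (d ∷ p) Fin.zero    = ε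
  vertexAt-reach (d ∷ p) (Fin.suc i) = d ◅ vertexAt-reach p i

  vertexAt-injective : ∀ {k c a} (p : Chain k c a) → Injective _≡_ _≡_ (vertexAt p)
  vertexAt-injective []      {Fin.zero}  {Fin.zero}  _  = refl
  vertexAt-injective (d ∷ p) {Fin.zero}  {Fin.zero}  _  = refl
  vertexAt-injective (d ∷ p) {Fin.zero}  {Fin.suc j} eq = contradiction (subst (Reach D _) (sym eq) (vertexAt-reach p j)) (acyclic d)
  vertexAt-injective (d ∷ p) {Fin.suc i} {Fin.zero}  eq = contradiction (subst (Reach D _) eq (vertexAt-reach p i)) (acyclic d)
  vertexAt-injective (d ∷ p) {Fin.suc i} {Fin.suc j} eq = cong Fin.suc (vertexAt-injective p eq)

  ReachedFromSource : Fin n → Set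
  ReachedFromSource a = ∃[ s ] (IsSource D s × Reach D s a)

  ¬¬-reachedOrChain : ∀ k a → ¬ ¬ (ReachedFromSource a ⊎ ∃[ c ] Chain k c a)
  ¬¬-reachedOrChain zero    a = return (inj₂ (a , []))
  ¬¬-reachedOrChain (suc k) a = do
    inj₂ (c , p) ← ¬¬-reachedOrChain k a
      where inj₁ r → return (inj₁ r)
    no c-not-source ← ¬¬-excluded-middle {A = IsSource D c}
      where yes c-source → return (inj₁ (c , c-source , chain⇒reach p))
    (b , d) ← contraposition ¬∃⟶∀¬ c-not-source
    return (inj₂ (b , d ∷ p))

  -- A backward chain of n arcs would visit n + 1 distinct vertices.
  ¬¬-reachedFromSource : ∀ a → ¬ ¬ ReachedFromSource a
  ¬¬-reachedFromSource a = do
    inj₂ (c , p) ← ¬¬-reachedOrChain n a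
      where inj₁ r → return r
    contradiction (Fin.injective⇒≤ (vertexAt-injective p)) ℕ.1+n≰n

point : Graph 1
point = record { Adj = λ _ _ → ⊥ ; sym = λ () ; irrefl = λ () }

point-isTree : IsTree point
point-isTree = record
  { path   = λ { Fin.zero Fin.zero → [] , [] ∷ [] }
  ; unique = λ { Fin.zero Fin.zero ([] , _) ([] , _) → refl } }

module _ {n : ℕ} (D : Fin n → Fin n → Set) where

  singleBagDecomposition : (S : Subset n) → (∀ s → s ∈ S ⇔ IsSource D s) → DagTreeDecomposition D
  singleBagDecomposition S S≡sources = record
    { k        = 1
    ; T        = point
    ; isTree   = point-isTree
    ; bag      = λ _ → S
    ; bagSrc   = λ _ s∈S → Equivalence.to (S≡sources _) s∈S
    ; cover    = λ s source → Fin.zero , Equivalence.from (S≡sources s) source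
    ; interpol = λ _ _ _ _ _ r₁ _ → r₁ }

  ¬¬-sourceSet : ¬ ¬ (Σ (Subset n) λ S → ∀ s → s ∈ S ⇔ IsSource D s)
  ¬¬-sourceSet = do
    source? ← ¬¬-∀-Fin (λ s → ¬¬-excluded-middle {A = IsSource D s})
    return (tabulate (isYes ∘ source?) , λ s →
      mk⇔ (toWitness {a? = source? s} ∘ Equivalence.from T-≡ ∘ Equivalence.to (∈-tabulate⇔ _))
          (Equivalence.from (∈-tabulate⇔ _) ∘ Equivalence.to T-≡ ∘ fromWitness {a? = source? s}))

  ¬¬-decomposition : ¬ ¬ DagTreeDecomposition D
  ¬¬-decomposition = do
    (S , S≡sources) ← ¬¬-sourceSet
    return (singleBagDecomposition S S≡sources)

NarrowerThan : ∀ {m n} → (Fin m → Fin m → Set) → (Fin n → Fin n → Set) → Set₁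
NarrowerThan DI DH = (dH : DagTreeDecomposition DH) → Σ (DagTreeDecomposition DI) λ dI → width dI ≤ width dH

RB-preimage : ∀ {m n} → (Fin m → Fin m → Set) → (Fin m → Fin n) → Subset n → Fin m → Set
RB-preimage DI f B z = ∃[ x ] (f x ∈ B × Reach DI x z)

module _ {m n} {DI : Fin m → Fin m → Set} {DH : Fin n → Fin n → Set}
         (f : Fin m → Fin n) (f-injective : Injective _≡_ _≡_ f) (dH : DagTreeDecomposition DH) where

  pullbackDecomposition :
    (∀ x → IsSource DH (f x) → IsSource DI x) →
    (∀ x → IsSource DI x → IsSource DH (f x)) →
    (∀ b b₁ b₂ → OnPath (T dH) b b₁ b₂ → ∀ z →
       RB-preimage DI f (bag dH b₁) z → RB-preimage DI f (bag dH b₂) z → RB-preimage DI f (bag dH b) z) →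
    Σ (DagTreeDecomposition DI) λ dI → width dI ≤ width dH
  pullbackDecomposition reflectSource preserveSource interpolate =
    dI , maxOver-mono-≤ (k dH) (λ b → ∣preimage∣≤ f f-injective (bag dH b))
    where
    fromPreimage : ∀ {B z} → RB DI (preimage f B) z → RB-preimage DI f B z
    fromPreimage (x , x∈ , r) = x , ∈-preimage⁻ f x∈ , r
    toPreimage : ∀ {B z} → RB-preimage DI f B z → RB DI (preimage f B) z
    toPreimage (x , fx∈ , r) = x , ∈-preimage⁺ f fx∈ , r
    dI : DagTreeDecomposition DI
    dI = record
      { k        = k dH
      ; T        = T dH
      ; isTree   = isTree dH
      ; bag      = λ b → preimage f (bag dH b)
      ; bagSrc   = λ b x∈ → reflectSource _ (bagSrc dH b (∈-preimage⁻ f x∈))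
      ; cover    = λ x source → Product.map₂ (∈-preimage⁺ f) (cover dH (f x) (preserveSource x source))
      ; interpol = λ b b₁ b₂ onPath z r₁ r₂ →
          toPreimage (interpolate b b₁ b₂ onPath z (fromPreimage r₁) (fromPreimage r₂)) }

  embedding⇒narrower :
    (∀ {x y} → DI x y → DH (f x) (f y)) →
    (∀ {a z} → Reach DH a (f z) → ∃[ x ] (a ≡ f x × Reach DI x z)) →
    (∀ x → IsSource DI x → IsSource DH (f x)) →
    Σ (DagTreeDecomposition DI) λ dI → width dI ≤ width dH
  embedding⇒narrower arc reflectReach preserveSource =
    pullbackDecomposition (λ x source y d → source (f y) (arc d)) preserveSource interpolate
    where
    push : ∀ {B z} → RB-preimage DI f B z → RB DH B (f z)
    push (x , fx∈ , r) = f x , fx∈ , gmap f arc r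
    pull : ∀ {B z} → RB DH B (f z) → RB-preimage DI f B z
    pull (s , s∈ , r) with reflectReach r
    ... | x , refl , r′ = x , s∈ , r′
    interpolate : ∀ b b₁ b₂ → OnPath (T dH) b b₁ b₂ → ∀ z →
      RB-preimage DI f (bag dH b₁) z → RB-preimage DI f (bag dH b₂) z → RB-preimage DI f (bag dH b) z
    interpolate b b₁ b₂ onPath z r₁ r₂ = pull (interpol dH b b₁ b₂ onPath (f z) (push r₁) (push r₂))

Dominated : ∀ {m n} → Graph m → Graph n → Set₁
Dominated I H = (OI : AcyclicOrientation I) →
                ¬ ¬ (Σ (AcyclicOrientation H) λ OH → NarrowerThan (D OI) (D OH))

dominated-trans : ∀ {a b c} {A : Graph a} {B : Graph b} {C : Graph c} →
                  Dominated A B → Dominated B C → Dominated A C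
dominated-trans A≼B B≼C OA = do
  (OB , narrowerAB) ← A≼B OA
  (OC , narrowerBC) ← B≼C OB
  return (OC , λ dC → let (dB , dB≤dC) = narrowerBC dC
                          (dA , dA≤dB) = narrowerAB dB
                      in dA , ℕ.≤-trans dA≤dB dB≤dC)

≅⇒dominated : ∀ {m n} {I : Graph m} {H : Graph n} → I ≅ H → Dominated I H
≅⇒dominated {n = n} {I} {H} I≅H OI = return (OH , λ dH → embedding⇒narrower to to-injective dH arc reflectReach preserveSource)
  where
  open Inverse (_≅_.bij I≅H) using (to; from; strictlyInverseˡ; strictlyInverseʳ)
  module OI = IsOrientation (isOrient OI)
  DI = D OI
  DH : Fin n → Fin n → Set
  DH a c = DI (from a) (from c)
  adj⇔ : ∀ x y → Adj I x y ⇔ Adj H (to x) (to y)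
  adj⇔ = _≅_.preserve I≅H
  OH : AcyclicOrientation H
  OH = record
    { D        = DH
    ; isOrient = record
      { arc⇒edge = λ {a} {c} d → subst₂ (Adj H) (strictlyInverseˡ a) (strictlyInverseˡ c)
                                   (Equivalence.to (adj⇔ (from a) (from c)) (OI.arc⇒edge d))
      ; edge⇒arc = λ {a} {c} e → OI.edge⇒arc (Equivalence.from (adj⇔ (from a) (from c))
                                   (subst₂ (Adj H) (sym (strictlyInverseˡ a)) (sym (strictlyInverseˡ c)) e))
      ; antisym  = OI.antisym }
    ; acyclic  = λ d r → acyclic OI d (gmap from id r) }
  to-injective : Injective _≡_ _≡_ to
  to-injective {x} {y} eq = trans (sym (strictlyInverseʳ x)) (trans (cong from eq) (strictlyInverseʳ y))
  arc : ∀ {x y} → DI x y → DH (to x) (to y)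
  arc {x} {y} = subst₂ DI (sym (strictlyInverseʳ x)) (sym (strictlyInverseʳ y))
  reflectReach : ∀ {a z} → Reach DH a (to z) → ∃[ x ] (a ≡ to x × Reach DI x z)
  reflectReach {a} {z} r = from a , sym (strictlyInverseˡ a) , subst (Reach DI (from a)) (strictlyInverseʳ z) (gmap from id r)
  preserveSource : ∀ x → IsSource DI x → IsSource DH (to x)
  preserveSource x source u d = source (from u) (subst (DI (from u)) (strictlyInverseʳ x) d)

-- Vertex deletion

module DeletionOrientation {n} (H : Graph (suc n)) (v : Fin (suc n)) (OI : AcyclicOrientation (deleteVertex H v)) where

  open PunchIn v
  private
    module OI = IsOrientation (isOrient OI)
    DI = D OI

  DH : Fin (suc n) → Fin (suc n) → Set
  DH a c = (c ≡ v × Adj H a v) ⊎ ∃[ x ] ∃[ y ] (a ≡ ↑ x × c ≡ ↑ y × DI x y)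

  ↑-arc : ∀ {x y} → DI x y → DH (↑ x) (↑ y)
  ↑-arc d = inj₂ (_ , _ , refl , refl , d)

  reach-from-v : ∀ {c} → Reach DH v c → c ≡ v
  reach-from-v ε                                = refl
  reach-from-v (inj₁ (refl , e) ◅ _)            = contradiction e (Graph.irrefl H)
  reach-from-v (inj₂ (x , _ , v≡↑x , _) ◅ _)    = contradiction (sym v≡↑x) (↑≢v x)

  reach-from-↑ : ∀ {x c} → Reach DH (↑ x) c → c ≡ v ⊎ ∃[ y ] (c ≡ ↑ y × Reach DI x y)
  reach-from-↑ ε                                      = inj₂ (_ , refl , ε)
  reach-from-↑ (inj₁ (refl , _) ◅ r)                  = inj₁ (reach-from-v r)
  reach-from-↑ (inj₂ (_ , _ , ↑x≡↑x′ , refl , d) ◅ r) =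
    Sum.map₂ (Product.map₂ (Product.map₂ (subst (λ x → DI x _) (sym (↑-injective ↑x≡↑x′)) d ◅_))) (reach-from-↑ r)

  reflectReach : ∀ {a z} → Reach DH a (↑ z) → ∃[ x ] (a ≡ ↑ x × Reach DI x z)
  reflectReach {a} {z} r with ↑-view a
  ... | inj₁ refl          = contradiction (reach-from-v r) (↑≢v z)
  ... | inj₂ (x , refl) with reach-from-↑ r
  ...   | inj₁ ↑z≡v           = contradiction ↑z≡v (↑≢v z)
  ...   | inj₂ (y , ↑z≡↑y , r′) = x , refl , subst (Reach DI x) (sym (↑-injective ↑z≡↑y)) r′

  edge⇒arc : ∀ {a c} → Adj H a c → DH a c ⊎ DH c a
  edge⇒arc {a} {c} e with ↑-view a | ↑-view c
  ... | _               | inj₁ refl       = inj₁ (inj₁ (refl , e))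
  ... | inj₁ refl       | inj₂ _          = inj₂ (inj₁ (refl , Graph.sym H e))
  ... | inj₂ (x , refl) | inj₂ (y , refl) = Sum.map ↑-arc ↑-arc (OI.edge⇒arc e)

  antisym : ∀ {a c} → DH a c → ¬ DH c a
  antisym (inj₁ (refl , e)) (inj₁ (refl , _))                     = Graph.irrefl H e
  antisym (inj₁ (refl , _)) (inj₂ (x , _ , v≡↑x , _))             = ↑≢v x (sym v≡↑x)
  antisym (inj₂ (x , _ , refl , refl , _)) (inj₁ (↑x≡v , _))      = ↑≢v x ↑x≡v
  antisym (inj₂ (_ , _ , refl , refl , d)) (inj₂ (_ , _ , e₁ , e₂ , d′)) =
    OI.antisym d (subst₂ DI (sym (↑-injective e₁)) (sym (↑-injective e₂)) d′)

  acyclicH : IsAcyclic DH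
  acyclicH (inj₁ (refl , e)) r = Graph.irrefl H (subst (λ a → Adj H a v) (reach-from-v r) e)
  acyclicH (inj₂ (x , y , refl , refl , d)) r with reflectReach r
  ... | _ , ↑y≡↑x′ , r′ = acyclic OI d (subst (λ y → Reach DI y x) (sym (↑-injective ↑y≡↑x′)) r′)

  OH : AcyclicOrientation H
  OH = record
    { D        = DH
    ; isOrient = record
      { arc⇒edge = λ { (inj₁ (refl , e)) → e ; (inj₂ (_ , _ , refl , refl , d)) → OI.arc⇒edge d }
      ; edge⇒arc = edge⇒arc
      ; antisym  = antisym }
    ; acyclic  = acyclicH }

  preserveSource : ∀ x → IsSource DI x → IsSource DH (↑ x)
  preserveSource x source _ (inj₁ (↑x≡v , _))                = ↑≢v x ↑x≡v
  preserveSource x source _ (inj₂ (x′ , _ , _ , ↑x≡↑y , d)) = source x′ (subst (DI x′) (sym (↑-injective ↑x≡↑y)) d)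

deleteVertex-dominated : ∀ {n} (H : Graph (suc n)) v → Dominated (deleteVertex H v) H
deleteVertex-dominated H v OI =
  return (OH , λ dH → embedding⇒narrower (punchIn v) (Fin.punchIn-injective v _ _) dH ↑-arc reflectReach preserveSource)
  where open DeletionOrientation H v OI

-- Edge contraction

module ContractionMap {n} (H : Graph (suc n)) (u v : Fin (suc n)) (e : Adj H u v) where

  I : Graph n
  I = contract H u v e

  open PunchIn v

  adj⇒≢ : ∀ {a c} → Adj H a c → a ≢ c
  adj⇒≢ adj refl = Graph.irrefl H adj

  u≢v : u ≢ v
  u≢v = adj⇒≢ e

  merged : Fin n
  merged = punchOut (u≢v ∘ sym)

  ↑-merged : ↑ merged ≡ u
  ↑-merged = Fin.punchIn-punchOut _

  π : Fin (suc n) → Fin n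
  π a with a Fin.≟ v
  ... | yes _   = merged
  ... | no  a≢v = punchOut (a≢v ∘ sym)

  π-v : π v ≡ merged
  π-v with v Fin.≟ v
  ... | yes _   = refl
  ... | no  v≢v = contradiction refl v≢v

  ↑-π : ∀ {a} → a ≢ v → ↑ (π a) ≡ a
  ↑-π {a} a≢v with a Fin.≟ v
  ... | yes a≡v = contradiction a≡v a≢v
  ... | no  _   = Fin.punchIn-punchOut _

  π-↑ : ∀ x → π (↑ x) ≡ x
  π-↑ x = ↑-injective (↑-π (↑≢v x))

  π-u : π u ≡ merged
  π-u = trans (cong π (sym ↑-merged)) (π-↑ merged)

  π⁻¹-merged : ∀ {a} → π a ≡ merged → a ≡ u ⊎ a ≡ v
  π⁻¹-merged {a} πa≡m with ↑-view a
  ... | inj₁ a≡v        = inj₂ a≡v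
  ... | inj₂ (x , refl) = inj₁ (trans (cong ↑ (trans (sym (π-↑ x)) πa≡m)) ↑-merged)

  π-collision : ∀ {a c} → π a ≡ π c → a ≢ c → π a ≡ merged
  π-collision {a} {c} πa≡πc a≢c with ↑-view a | ↑-view c
  ... | inj₁ refl       | _               = π-v
  ... | inj₂ _          | inj₁ refl       = trans πa≡πc π-v
  ... | inj₂ (x , refl) | inj₂ (y , refl) =
    contradiction (cong ↑ (trans (sym (π-↑ x)) (trans πa≡πc (π-↑ y)))) a≢c

  π-edge : ∀ {a c} → Adj H a c → π a ≢ π c → Adj I (π a) (π c)
  π-edge {a} {c} adj πa≢πc with ↑-view a | ↑-view c
  ... | inj₁ refl       | inj₁ refl       = contradiction adj (Graph.irrefl H)
  ... | inj₁ refl       | inj₂ (y , refl) =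
    πa≢πc , inj₂ (inj₁ (trans (cong ↑ π-v) ↑-merged , subst (Adj H v) (sym (↑-π (↑≢v y))) adj))
  ... | inj₂ (x , refl) | inj₁ refl       =
    πa≢πc , inj₂ (inj₂ (trans (cong ↑ π-v) ↑-merged , subst (λ a → Adj H a v) (sym (↑-π (↑≢v x))) adj))
  ... | inj₂ (x , refl) | inj₂ (y , refl) =
    πa≢πc , inj₁ (subst₂ (Adj H) (sym (↑-π (↑≢v x))) (sym (↑-π (↑≢v y))) adj)

  ↑≡u⇒π-v≡ : ∀ {x} → ↑ x ≡ u → π v ≡ x
  ↑≡u⇒π-v≡ {x} ↑x≡u = trans π-v (trans (sym π-u) (trans (cong π (sym ↑x≡u)) (π-↑ x)))

  edge-lift : ∀ {x y} → Adj I x y → ∃[ a ] ∃[ c ] (π a ≡ x × π c ≡ y × Adj H a c)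
  edge-lift {x} {y} (_ , inj₁ adj)                 = ↑ x , ↑ y , π-↑ x , π-↑ y , adj
  edge-lift {x} {y} (_ , inj₂ (inj₁ (↑x≡u , adj))) = v , ↑ y , ↑≡u⇒π-v≡ ↑x≡u , π-↑ y , adj
  edge-lift {x} {y} (_ , inj₂ (inj₂ (↑y≡u , adj))) = ↑ x , v , π-↑ x , ↑≡u⇒π-v≡ ↑y≡u , adj

  -- {t, h} = {u, v}, the contracted edge to be oriented t → h.
  record Endpoints (t h : Fin (suc n)) : Set where
    field
      t≢h    : t ≢ h
      π-t    : π t ≡ merged
      π-h    : π h ≡ merged
      t—h    : Adj H t h
      fibre  : ∀ {a} → π a ≡ merged → a ≡ t ⊎ a ≡ h

  endpoints-uv : Endpoints u v
  endpoints-uv = record { t≢h = u≢v ; π-t = π-u ; π-h = π-v ; t—h = e ; fibre = π⁻¹-merged }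

  endpoints-swap : ∀ {t h} → Endpoints t h → Endpoints h t
  endpoints-swap ends = record
    { t≢h = t≢h ∘ sym ; π-t = π-h ; π-h = π-t ; t—h = Graph.sym H t—h ; fibre = Sum.swap ∘ fibre }
    where open Endpoints ends

  module Oriented (OI : AcyclicOrientation I) {t h} (ends : Endpoints t h)
                  (tail-inherits : (∃[ y ] D OI y merged) → ∃[ c ] (Adj H c t × D OI (π c) merged)) where

    open Endpoints ends
    private
      module OI = IsOrientation (isOrient OI)
      DI = D OI

    DI-irrefl : ∀ {x} → ¬ DI x x
    DI-irrefl = Graph.irrefl I ∘ OI.arc⇒edge

    π-h≡π-t : π h ≡ π t
    π-h≡π-t = trans π-h (sym π-t)

    DH : Fin (suc n) → Fin (suc n) → Set
    DH a c = Adj H a c × ((a ≡ t × c ≡ h) ⊎ DI (π a) (π c))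

    t⇒h : DH t h
    t⇒h = t—h , inj₁ (refl , refl)

    project : ∀ {a c} → Reach DH a c → Reach DI (π a) (π c)
    project ε                              = ε
    project ((_ , inj₁ (refl , refl)) ◅ r) = subst (λ x → Reach DI x _) π-h≡π-t (project r)
    project ((_ , inj₂ d) ◅ r)             = d ◅ project r

    collision : ∀ {a c} → π a ≡ π c → a ≢ c → (a ≡ t × c ≡ h) ⊎ (a ≡ h × c ≡ t)
    collision {a} {c} πa≡πc a≢c with fibre {a} (π-collision πa≡πc a≢c) | fibre {c} (trans (sym πa≡πc) (π-collision πa≡πc a≢c))
    ... | inj₁ refl | inj₂ refl = inj₁ (refl , refl)
    ... | inj₂ refl | inj₁ refl = inj₂ (refl , refl)
    ... | inj₁ refl | inj₁ refl = contradiction refl a≢c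
    ... | inj₂ refl | inj₂ refl = contradiction refl a≢c

    edge⇒arc : ∀ {a c} → Adj H a c → DH a c ⊎ DH c a
    edge⇒arc {a} {c} adj with π a Fin.≟ π c
    ... | no πa≢πc with OI.edge⇒arc (π-edge adj πa≢πc)
    ...   | inj₁ d = inj₁ (adj , inj₂ d)
    ...   | inj₂ d = inj₂ (Graph.sym H adj , inj₂ d)
    edge⇒arc {a} {c} adj | yes πa≡πc with collision πa≡πc (adj⇒≢ adj)
    ...   | inj₁ (refl , refl) = inj₁ (adj , inj₁ (refl , refl))
    ...   | inj₂ (refl , refl) = inj₂ (Graph.sym H adj , inj₁ (refl , refl))

    antisym : ∀ {a c} → DH a c → ¬ DH c a
    antisym (_ , inj₁ (refl , refl)) (_ , inj₁ (h≡t , _))   = t≢h (sym h≡t)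
    antisym (_ , inj₁ (refl , refl)) (_ , inj₂ d)           = DI-irrefl (subst (λ x → DI x _) π-h≡π-t d)
    antisym (_ , inj₂ d)             (_ , inj₁ (refl , refl)) = DI-irrefl (subst (λ x → DI x _) π-h≡π-t d)
    antisym (_ , inj₂ d)             (_ , inj₂ d′)          = OI.antisym d d′

    acyclicH : IsAcyclic DH
    acyclicH (_ , inj₂ d)             r                            = acyclic OI d (project r)
    acyclicH (_ , inj₁ (refl , refl)) ε                            = t≢h refl
    acyclicH (_ , inj₁ (refl , refl)) ((_ , inj₁ (h≡t , _)) ◅ _) = t≢h (sym h≡t)
    acyclicH (_ , inj₁ (refl , refl)) ((_ , inj₂ d) ◅ r)         =
      acyclic OI d (subst (Reach DI _) (sym π-h≡π-t) (project r))

    OH : AcyclicOrientation H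
    OH = record
      { D        = DH
      ; isOrient = record { arc⇒edge = proj₁ ; edge⇒arc = edge⇒arc ; antisym = antisym }
      ; acyclic  = acyclicH }

    source≢h : ∀ {a} → IsSource DH a → a ≢ h
    source≢h source refl = source t t⇒h

    source-t⇒ : IsSource DH t → IsSource DI merged
    source-t⇒ source y d = let (c , adj , d′) = tail-inherits (y , d)
                           in source c (adj , inj₂ (subst (DI (π c)) (sym π-t) d′))

    source-t⇐ : IsSource DI merged → IsSource DH t
    source-t⇐ source c (_ , inj₁ (_ , t≡h)) = t≢h t≡h
    source-t⇐ source c (_ , inj₂ d)        = source (π c) (subst (DI (π c)) π-t d)

    source-↑⇒ : ∀ {x} → x ≢ merged → IsSource DH (↑ x) → IsSource DI x
    source-↑⇒ {x} x≢m source y d with edge-lift (OI.arc⇒edge d)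
    ... | c , a , πc≡y , πa≡x , adj with a Fin.≟ ↑ x
    ...   | yes refl = source c (adj , inj₂ (subst₂ DI (sym πc≡y) (sym πa≡x) d))
    ...   | no  a≢↑x = x≢m (trans (sym πa≡x) (π-collision (trans πa≡x (sym (π-↑ x))) a≢↑x))

    source-↑⇐ : ∀ {x} → x ≢ merged → IsSource DI x → IsSource DH (↑ x)
    source-↑⇐ {x} x≢m source c (_ , inj₁ (_ , ↑x≡h)) = x≢m (trans (sym (π-↑ x)) (trans (cong π ↑x≡h) π-h))
    source-↑⇐ {x} x≢m source c (_ , inj₂ d)          = source (π c) (subst (DI (π c)) (π-↑ x) d)

    ι : Fin n → Fin (suc n)
    ι x with x Fin.≟ merged
    ... | yes _ = t
    ... | no  _ = ↑ x

    π-ι : ∀ x → π (ι x) ≡ x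
    π-ι x with x Fin.≟ merged
    ... | yes refl = π-t
    ... | no  _    = π-↑ x

    ι-injective : ∀ {x y} → ι x ≡ ι y → x ≡ y
    ι-injective {x} {y} ιx≡ιy = trans (sym (π-ι x)) (trans (cong π ιx≡ιy) (π-ι y))

    ι-π : ∀ {a} → a ≢ h → ι (π a) ≡ a
    ι-π {a} a≢h = go refl
      where
      go : ∀ {x} → π a ≡ x → ι x ≡ a
      go {x} πa≡x with x Fin.≟ merged
      ... | yes refl = Sum.[ sym , (λ a≡h → contradiction a≡h a≢h) ]′ (fibre πa≡x)
      ... | no  x≢m  = trans (cong ↑ (sym πa≡x)) (↑-π λ a≡v → x≢m (trans (sym πa≡x) (trans (cong π a≡v) π-v)))

    ι-reflectSource : ∀ x → IsSource DH (ι x) → IsSource DI x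
    ι-reflectSource x with x Fin.≟ merged
    ... | yes refl = source-t⇒
    ... | no  x≢m  = source-↑⇒ x≢m

    ι-preserveSource : ∀ x → IsSource DI x → IsSource DH (ι x)
    ι-preserveSource x with x Fin.≟ merged
    ... | yes refl = source-t⇐
    ... | no  x≢m  = source-↑⇐ x≢m

    data ArcLift (a : Fin (suc n)) (y : Fin n) : Set where
      lifted  : ∀ {c} → π c ≡ y → Reach DH a c → ArcLift a y
      blocked : a ≡ h → ArcLift a y

    arc-lift : ∀ {a x y} → DI x y → π a ≡ x → ArcLift a y
    arc-lift {a} d πa≡x with edge-lift (OI.arc⇒edge d)
    ... | a′ , c , πa′≡x , πc≡y , adj with a′ Fin.≟ a
    ...   | yes refl = lifted πc≡y ((adj , inj₂ (subst₂ DI (sym πa′≡x) (sym πc≡y) d)) ◅ ε)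
    ...   | no  a′≢a with collision (trans πa′≡x (sym πa≡x)) a′≢a
    ...     | inj₁ (refl , refl) = blocked refl
    ...     | inj₂ (refl , refl) =
      lifted πc≡y (t⇒h ◅ (adj , inj₂ (subst₂ DI (sym πa′≡x) (sym πc≡y) d)) ◅ ε)

    -- A path of I lifts to H unless it has to leave the merged vertex through t while at h.
    data ReachLift (a : Fin (suc n)) (z : Fin n) : Set where
      lifted      : ∀ {c} → π c ≡ z → Reach DH a c → ReachLift a z
      stuckAtHead : Reach DH a h → Reach DI merged z → ReachLift a z

    prepend : ∀ {a c z} → Reach DH a c → ReachLift c z → ReachLift a z
    prepend r (lifted πc≡z r′)    = lifted πc≡z (r ◅◅ r′)
    prepend r (stuckAtHead r′ rᴵ) = stuckAtHead (r ◅◅ r′) rᴵ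

    reach-lift : ∀ {a x z} → Reach DI x z → π a ≡ x → ReachLift a z
    reach-lift ε       πa≡x = lifted πa≡x ε
    reach-lift (d ◅ r) πa≡x with arc-lift d πa≡x
    ... | lifted πc≡y rc = prepend rc (reach-lift r πc≡y)
    ... | blocked refl   = stuckAtHead ε (subst (λ x → Reach DI x _) (trans (sym πa≡x) π-h) (d ◅ r))

    -- From t lifting never gets stuck: that would close a cycle through merged in I.
    reach-lift-tail : ∀ {z} → Reach DI merged z → ∃[ c ] (π c ≡ z × Reach DH t c)
    reach-lift-tail ε = t , π-t , ε
    reach-lift-tail (d ◅ r) with arc-lift d π-t
    ... | blocked t≡h = contradiction t≡h t≢h
    ... | lifted πc≡y rc with reach-lift r πc≡y
    ...   | lifted πc′≡z rc′ = _ , πc′≡z , rc ◅◅ rc′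
    ...   | stuckAtHead rh _ = contradiction (subst₂ (Reach DI) πc≡y π-h (project rh)) (acyclic OI d)

    representative : Fin n → Fin (suc n)
    representative z with z Fin.≟ merged
    ... | yes _ = h
    ... | no  _ = ↑ z

    π-representative : ∀ z → π (representative z) ≡ z
    π-representative z with z Fin.≟ merged
    ... | yes refl = π-h
    ... | no  _    = π-↑ z

    reach-representative : ∀ {a c z} → π c ≡ z → Reach DH a c → Reach DH a (representative z)
    reach-representative {a} {c} {z} πc≡z r with z Fin.≟ merged
    ... | yes refl = Sum.[ (λ { refl → r ◅◅ (t⇒h ◅ ε) }) , (λ { refl → r }) ]′ (fibre {c} πc≡z)
    ... | no  z≢m  = subst (Reach DH a) (trans (sym (↑-π {c} c≢v)) (cong ↑ πc≡z)) r
      where c≢v = λ c≡v → z≢m (trans (sym πc≡z) (trans (cong π c≡v) π-v))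

    module _ {s₀} (s₀-source : IsSource DH s₀) (s₀⇝t : Reach DH s₀ t) (dH : DagTreeDecomposition DH) where

      private
        Reached : Fin (k dH) → Fin n → Set
        Reached b = RB-preimage DI ι (bag dH b)

      pull : ∀ {b c} → RB DH (bag dH b) c → Reached b (π c)
      pull {b} (s , s∈ , r) = π s , subst (_∈ bag dH b) (sym (ι-π (source≢h (bagSrc dH b s∈)))) s∈ , project r

      pull-representative : ∀ {b z} → RB DH (bag dH b) (representative z) → Reached b z
      pull-representative {b} {z} = subst (Reached b) (π-representative z) ∘ pull

      pull-head : ∀ {b z} → Reach DI merged z → RB DH (bag dH b) h → Reached b z
      pull-head rz rh = let (x , x∈ , r) = pull rh in x , x∈ , subst (Reach DI x) π-h r ◅◅ rz

      s₀⇝h : Reach DH s₀ h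
      s₀⇝h = s₀⇝t ◅◅ (t⇒h ◅ ε)

      s₀⇝representative : ∀ {z} → Reach DI merged z → Reach DH s₀ (representative z)
      s₀⇝representative rz = let (c , πc≡z , t⇝c) = reach-lift-tail rz
                             in s₀⇝t ◅◅ reach-representative πc≡z t⇝c

      -- If exactly one side is stuck at h, interpolate through the bag b₀ of s₀ instead:
      -- s₀ reaches t, hence h, and (when merged ⇝ z) the representative of z.
      interpolate : ∀ b b₁ b₂ → OnPath (T dH) b b₁ b₂ → ∀ z → Reached b₁ z → Reached b₂ z → Reached b z
      interpolate b b₁ b₂ onPath z (x₁ , ιx₁∈ , r₁) (x₂ , ιx₂∈ , r₂) =
        combine (reach-lift r₁ (π-ι x₁)) (reach-lift r₂ (π-ι x₂))
        where
        b₀  = proj₁ (cover dH s₀ s₀-source)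
        s₀∈ = proj₂ (cover dH s₀ s₀-source)
        combine : ReachLift (ι x₁) z → ReachLift (ι x₂) z → Reached b z
        combine (lifted q₁ rc₁) (lifted q₂ rc₂) = pull-representative
          (interpol dH b b₁ b₂ onPath _ (_ , ιx₁∈ , reach-representative q₁ rc₁) (_ , ιx₂∈ , reach-representative q₂ rc₂))
        combine (stuckAtHead rh₁ rz) (stuckAtHead rh₂ _) = pull-head rz
          (interpol dH b b₁ b₂ onPath h (_ , ιx₁∈ , rh₁) (_ , ιx₂∈ , rh₂))
        combine (stuckAtHead rh₁ rz) (lifted q₂ rc₂) with onPath-split (T dH) (isTree dH) onPath b₀
        ... | inj₁ onPath′ = pull-head rz
          (interpol dH b b₁ b₀ onPath′ h (_ , ιx₁∈ , rh₁) (s₀ , s₀∈ , s₀⇝h))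
        ... | inj₂ onPath′ = pull-representative
          (interpol dH b b₀ b₂ onPath′ _ (s₀ , s₀∈ , s₀⇝representative rz) (_ , ιx₂∈ , reach-representative q₂ rc₂))
        combine (lifted q₁ rc₁) (stuckAtHead rh₂ rz) with onPath-split (T dH) (isTree dH) onPath b₀
        ... | inj₁ onPath′ = pull-representative
          (interpol dH b b₁ b₀ onPath′ _ (_ , ιx₁∈ , reach-representative q₁ rc₁) (s₀ , s₀∈ , s₀⇝representative rz))
        ... | inj₂ onPath′ = pull-head rz
          (interpol dH b b₀ b₂ onPath′ h (s₀ , s₀∈ , s₀⇝h) (_ , ιx₂∈ , rh₂))

      narrower : Σ (DagTreeDecomposition DI) λ dI → width dI ≤ width dH
      narrower = pullbackDecomposition ι ι-injective dH ι-reflectSource ι-preserveSource interpolate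

contract-dominated : ∀ {n} (H : Graph (suc n)) u v (e : Adj H u v) → Dominated (contract H u v e) H
contract-dominated H u v e OI = do
  yes inArc-u ← ¬¬-excluded-middle {A = ∃[ c ] (Adj H c u × D OI (π c) merged)}
    where no ¬inArc-u → orient (endpoints-swap endpoints-uv) (inArc-v ¬inArc-u)
  orient endpoints-uv (λ _ → inArc-u)
  where
  open ContractionMap H u v e
  orient : ∀ {t h} (ends : Endpoints t h) →
           ((∃[ y ] D OI y merged) → ∃[ c ] (Adj H c t × D OI (π c) merged)) →
           ¬ ¬ (Σ (AcyclicOrientation H) λ OH → NarrowerThan (D OI) (D OH))
  orient {t} ends tail-inherits = do
      (s₀ , s₀-source , s₀⇝t) ← ¬¬-reachedFromSource acyclicH t
      return (OH , narrower s₀-source s₀⇝t)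
    where open Oriented OI ends tail-inherits
  inArc-v : ¬ (∃[ c ] (Adj H c u × D OI (π c) merged)) →
            (∃[ y ] D OI y merged) → ∃[ c ] (Adj H c v × D OI (π c) merged)
  inArc-v ¬inArc-u (y , d) with edge-lift (IsOrientation.arc⇒edge (isOrient OI) d)
  ... | c , a , πc≡y , πa≡m , adj with π⁻¹-merged {a} πa≡m
  ...   | inj₁ refl = contradiction (c , adj , subst (λ x → D OI x merged) (sym πc≡y) d) ¬inArc-u
  ...   | inj₂ refl = c , adj , subst (λ x → D OI x merged) (sym πc≡y) d

indMinor⇒dominated : ∀ {m n} {I : Graph m} {H : Graph n} → IndMinor I H → Dominated I H
indMinor⇒dominated (iso I≅H)      = ≅⇒dominated I≅H
indMinor⇒dominated (del v m)      = dominated-trans (indMinor⇒dominated m) (deleteVertex-dominated _ v)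
indMinor⇒dominated (con u v e m)  = dominated-trans (indMinor⇒dominated m) (contract-dominated _ u v e)

dominated⇒dtw≤ : ∀ {m n} {I : Graph m} {H : Graph n} → Dominated I H →
                 ∀ {a b} → IsDtw H a → IsDtw I b → b ≤ a
dominated⇒dtw≤ I≼H {a} {b} (_ , dtwH-maximal) ((OI , _ , dtwI-minimal) , _) = decidable-stable (b ℕ.≤? a) do
  (OH , narrower) ← I≼H OI
  dH₀ ← ¬¬-decomposition (D OH)
  (w , (dH , width≡w) , w-least) ← ¬¬-least (λ w → ∃[ dH ] width {D = D OH} dH ≡ w) (dH₀ , refl)
  let (dI , dI≤dH) = narrower dH
      dtwH≤a       = dtwH-maximal OH w ((dH , width≡w) , λ dH′ → w-least _ (dH′ , refl))
  return (ℕ.≤-trans (dtwI-minimal dI) (ℕ.≤-trans dI≤dH (subst (_≤ a) (sym width≡w) dtwH≤a)))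

mainTheorem14 : ∀ {m n} (H : Graph n) (I : Graph m) → IndMinor I H →
                ∀ a b → IsDtw H a → IsDtw I b → b ≤ a
mainTheorem14 H I I≤H a b = dominated⇒dtw≤ (indMinor⇒dominated I≤H)
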